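{- If a matrix $A\in\mathcal{M}_{r\times m}(\mathbb{Z})$ is partition regular or density regular, then it is abundant.
   Context: $[n]=\{1,\dots,n\}$. $\mathcal{S}_0(A)=\{\mathbf{x}\in\mathbb{Z}^m:A\mathbf{x}^T=\mathbf{0},\ x_i\ne x_j\text{ for }i\ne j\}$; $A$ is irredundant if $\mathcal{S}_0(A)\ne\emptyset$. $A$ is partition regular if it is irredundant and for every $s\in\mathbb{N}$ and all $n$ large enough, for every partition $[n]=T_1\dot\cup\dots\dot\cup T_s$ some $T_i$ satisfies $T_i^m\cap\mathcal{S}_0(A)\ne\emptyset$. $A$ is density regular if it is irredundant and for every $\epsilon>0$ and all $n$ large enough, every $S\subseteq[n]$ with $|S|\ge\epsilon n$ satisfies $S^m\cap\mathcal{S}_0(A)\ne\emptyset$. $A$ is abundant if every $r\times(m-2)$ submatrix obtained from $A$ by deleting two columns has the same rank as $A$. -}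

module Defs where

open import Data.Nat as ℕ using (ℕ; zero; suc; _≤_; _*_)
open import Data.Integer as ℤ using (ℤ; +_; 0ℤ; 1ℤ; -_)
open import Data.Fin using (Fin; zero; suc; toℕ; punchIn; punchOut)
open import Data.Fin.Subset using (Subset; _∈_; ∣_∣)
open import Data.Product using (Σ; ∃; _×_; _,_)
open import Data.Unit using (⊤)
open import Function.Definitions using (Injective)
open import Relation.Binary.PropositionalEquality using (_≡_; _≢_)
open import Relation.Nullary using (¬_)

Matrix : ℕ → ℕ → Set
Matrix r m = Fin r → Fin m → ℤ

sumFin : (n : ℕ) → (Fin n → ℤ) → ℤ
sumFin zero    f = 0ℤ
sumFin (suc n) f = f zero ℤ.+ sumFin n (λ j → f (suc j))

sgn : ∀ {n} → Fin n → ℤ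
sgn zero    = 1ℤ
sgn (suc j) = - sgn j

det : (n : ℕ) → Matrix n n → ℤ
det zero    M = 1ℤ
det (suc n) M = sumFin (suc n) (λ j →
  sgn j ℤ.* (M zero j ℤ.* det n (λ a b → M (suc a) (punchIn j b))))

HasNonzeroMinor : ∀ {r m} → Matrix r m → ℕ → Set
HasNonzeroMinor {r} {m} A k =
  Σ (Fin k → Fin r) λ ρ → Σ (Fin k → Fin m) λ κ →
    Injective _≡_ _≡_ ρ × Injective _≡_ _≡_ κ ×
    (det k (λ a b → A (ρ a) (κ b)) ≢ 0ℤ)

IsRank : ∀ {r m} → Matrix r m → ℕ → Set
IsRank A k = HasNonzeroMinor A k × (∀ k' → HasNonzeroMinor A k' → k' ≤ k)

deleteTwo : ∀ {r m} → Matrix r (suc (suc m)) →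
            (j₁ j₂ : Fin (suc (suc m))) → j₁ ≢ j₂ → Matrix r m
deleteTwo A j₁ j₂ ne a b = A a (punchIn j₁ (punchIn (punchOut ne) b))

Abundant : ∀ {r m} → Matrix r m → Set
Abundant {r} {zero}        A = ⊤
Abundant {r} {suc zero}    A = ⊤
Abundant {r} {suc (suc m)} A =
  ∀ (j₁ j₂ : Fin (suc (suc m))) (ne : j₁ ≢ j₂) →
    ∀ k → IsRank A k → IsRank (deleteTwo A j₁ j₂ ne) k

IsSolution : ∀ {r m} → Matrix r m → (Fin m → ℤ) → Set
IsSolution {r} {m} A x = ∀ i → sumFin m (λ j → A i j ℤ.* x j) ≡ 0ℤ

InS₀ : ∀ {r m} → Matrix r m → (Fin m → ℤ) → Set
InS₀ A x = IsSolution A x × (∀ i j → i ≢ j → x i ≢ x j)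

Irredundant : ∀ {r m} → Matrix r m → Set
Irredundant {r} {m} A = ∃ λ (x : Fin m → ℤ) → InS₀ A x

-- The element k : Fin n stands for the integer k+1 ∈ [n].
elt : ∀ {n} → Fin n → ℤ
elt k = + suc (toℕ k)

-- A partition [n] = T₁ ∪ … ∪ Tₛ is a colouring c : [n] → Fin s.
PartitionRegular : ∀ {r m} → Matrix r m → Set
PartitionRegular {r} {m} A =
  Irredundant A ×
  (∀ (s : ℕ) → ∃ λ n₀ → ∀ n → n₀ ≤ n → ∀ (c : Fin n → Fin s) →
     ∃ λ (i : Fin s) → ∃ λ (y : Fin m → Fin n) →
       (∀ j → c (y j) ≡ i) × InS₀ A (λ j → elt (y j)))

-- ε > 0 is represented as the positive rational p / q (p, q ≥ 1);
-- |S| ≥ ε n  ⇔  p * n ≤ q * |S|.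
DensityRegular : ∀ {r m} → Matrix r m → Set
DensityRegular {r} {m} A =
  Irredundant A ×
  (∀ (p q : ℕ) → 1 ≤ p → 1 ≤ q → ∃ λ n₀ → ∀ n → n₀ ≤ n →
     ∀ (S : Subset n) → p * n ≤ q * ∣ S ∣ →
       ∃ λ (y : Fin m → Fin n) → (∀ j → y j ∈ S) × InS₀ A (λ j → elt (y j)))

{-# OPTIONS --safe #-}
module Submission where

-- Suppose deleting the columns j₁ ≠ j₂ lowered the rank k of A, and take a nonsingular k × k
-- minor of A with rows ρ and columns κ. For a solution x the column Σⱼ xⱼ A[ρ, j] vanishes, so
-- putting it in place of column b and expanding by multilinearity gives the Cramer identity
-- Σⱼ det(A[ρ, κ[b ≔ j]]) xⱼ = 0, in which the terms with j among the other columns of κ vanish.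
-- Hence κ b can be exchanged for some column j ∉ κ, j ≠ j', keeping the minor nonsingular,
-- unless every solution satisfies α x_{κ b} + β x_{j'} = 0 with α = det(A[ρ, κ]) ≠ 0; without
-- such relations two exchanges give a nonsingular k × k minor avoiding j₁ and j₂.
-- Regularity excludes these relations already on positive solutions: |α| = |β| contradicts the
-- distinctness of the entries, and for g = |β| < a = |α| the equation a u = g w is avoided both by
-- the 2-colouring of ℕ that flips along w ↦ g w / a and by the top part (g n, a n] of [a n], whose
-- density is at least 1/a and on which a u > g a n ≥ g w.

open import Algebra.Bundles using (AbelianGroup)
open import Data.Bool using (Bool; false; not)
open import Data.Bool.Properties using (not-¬)
open import Data.Empty using (⊥-elim)
open import Data.Fin as F using (Fin; zero; suc; toℕ; punchIn; punchOut; inject₁)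
open import Data.Fin.Properties as FP using (2↔Bool)
import Data.Fin.Permutation as Perm
import Data.Fin.Permutation.Components as PC
open import Data.Fin.Subset using (Subset; ⊤; outside; _∈_; ∣_∣)
import Data.Fin.Subset.Properties as SubsetP
open import Data.Integer as ℤ using (ℤ; +[1+_]; -[1+_]; 0ℤ; -_; _+_; _*_)
import Data.Integer.Properties as ℤP
open import Data.Integer.Tactic.RingSolver using (solve-∀)
open import Data.Nat as ℕ using (ℕ; zero; suc)
open import Data.Nat.Divisibility using (_∣?_; divides)
import Data.Nat.Properties as ℕP
open import Data.Product using (∃; _×_; _,_; proj₁; proj₂)
open import Data.Sum using (_⊎_; inj₁; inj₂)
open import Data.Unit using (tt)
open import Data.Vec using ([]; _∷_; there)
open import Data.Vec.Functional using (updateAt; removeAt)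
open import Data.Vec.Functional.Properties using (updateAt-updates; updateAt-minimal; updateAt-id-local)
open import Function using (_∘_; const)
open import Function.Bundles using (Inverse)
open import Function.Definitions using (Injective)
open import Relation.Binary.Definitions using (tri<; tri≈; tri>)
open import Relation.Binary.PropositionalEquality
open import Relation.Nullary using (¬_; Dec; yes; no; ¬?; _×-dec_)
open import Relation.Nullary.Decidable using (dec-true; dec-false; toSum)

open import Algebra.Properties.Semiring.Sum ℤP.+-*-semiring
  using (sum; sum-cong-≗; sum-remove; sum-replicate-zero; ∑-comm; ∑-permute; *-distribˡ-sum; *-distribʳ-sum)
open import Algebra.Properties.Group (AbelianGroup.group ℤP.+-0-abelianGroup) using (inverseʳ-unique)
open import Algebra.Properties.CommutativeSemigroup ℕP.*-commutativeSemigroup using (x∙yz≈y∙xz)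

open import Defs

sumFin≡sum : ∀ n (f : Fin n → ℤ) → sumFin n f ≡ sum f
sumFin≡sum zero    f = refl
sumFin≡sum (suc n) f = cong (f zero +_) (sumFin≡sum n (f ∘ suc))

sumFin-cong : ∀ n {f g : Fin n → ℤ} → (∀ j → f j ≡ g j) → sumFin n f ≡ sumFin n g
sumFin-cong zero    f≗g = refl
sumFin-cong (suc n) f≗g = cong₂ _+_ (f≗g zero) (sumFin-cong n (f≗g ∘ suc))

*-distribˡ-sumFin : ∀ n x (f : Fin n → ℤ) → x * sumFin n f ≡ sumFin n (λ j → x * f j)
*-distribˡ-sumFin n x f = begin
  x * sumFin n f            ≡⟨ cong (x *_) (sumFin≡sum n f) ⟩
  x * sum f                 ≡⟨ *-distribˡ-sum x f ⟩
  sum (λ j → x * f j)       ≡⟨ sumFin≡sum n _ ⟨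
  sumFin n (λ j → x * f j)  ∎
  where open ≡-Reasoning

*-distribʳ-sumFin : ∀ n x (f : Fin n → ℤ) → sumFin n f * x ≡ sumFin n (λ j → f j * x)
*-distribʳ-sumFin n x f = begin
  sumFin n f * x            ≡⟨ cong (_* x) (sumFin≡sum n f) ⟩
  sum f * x                 ≡⟨ *-distribʳ-sum x f ⟩
  sum (λ j → f j * x)       ≡⟨ sumFin≡sum n _ ⟨
  sumFin n (λ j → f j * x)  ∎
  where open ≡-Reasoning

neg-distrib-sumFin : ∀ n (f : Fin n → ℤ) → - sumFin n f ≡ sumFin n (λ j → - f j)
neg-distrib-sumFin zero    f = refl
neg-distrib-sumFin (suc n) f =
  trans (ℤP.neg-distrib-+ (f zero) _) (cong (- f zero +_) (neg-distrib-sumFin n (f ∘ suc)))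

sumFin-comm : ∀ m n (f : Fin m → Fin n → ℤ) →
  sumFin m (λ i → sumFin n (f i)) ≡ sumFin n (λ j → sumFin m (λ i → f i j))
sumFin-comm m n f = begin
  sumFin m (λ i → sumFin n (f i))          ≡⟨ sumFin≡sum m _ ⟩
  sum (λ i → sumFin n (f i))               ≡⟨ sum-cong-≗ {m} (λ i → sumFin≡sum n (f i)) ⟩
  sum (λ i → sum (f i))                    ≡⟨ ∑-comm f ⟩
  sum (λ j → sum (λ i → f i j))            ≡⟨ sum-cong-≗ {n} (λ j → sumFin≡sum m _) ⟨
  sum (λ j → sumFin m (λ i → f i j))       ≡⟨ sumFin≡sum n _ ⟨
  sumFin n (λ j → sumFin m (λ i → f i j))  ∎
  where open ≡-Reasoning

sumFin-transpose : ∀ n (f : Fin n → ℤ) (i j : Fin n) → sumFin n (f ∘ PC.transpose i j) ≡ sumFin n f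
sumFin-transpose n f i j = begin
  sumFin n (f ∘ PC.transpose i j)  ≡⟨ sumFin≡sum n _ ⟩
  sum (f ∘ PC.transpose i j)       ≡⟨ ∑-permute f (Perm.transpose i j) ⟨
  sum f                            ≡⟨ sumFin≡sum n f ⟨
  sumFin n f                       ∎
  where open ≡-Reasoning

sum-zero : ∀ {n} {f : Fin n → ℤ} → (∀ j → f j ≡ 0ℤ) → sum f ≡ 0ℤ
sum-zero {n} f≡0 = trans (sum-cong-≗ f≡0) (sum-replicate-zero n)

sumFin-pair : ∀ n (f : Fin n → ℤ) {i i'} → i ≢ i' →
  (∀ j → j ≢ i → j ≢ i' → f j ≡ 0ℤ) → sumFin n f ≡ f i + f i'
sumFin-pair (suc zero)    f {zero} {zero} i≢i' _    = ⊥-elim (i≢i' refl)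
sumFin-pair (suc (suc n)) f {i}    {i'}   i≢i' rest = begin
  sumFin (suc (suc n)) f                           ≡⟨ sumFin≡sum (suc (suc n)) f ⟩
  sum f                                            ≡⟨ sum-remove f ⟩
  f i + sum (removeAt f i)                         ≡⟨ cong (f i +_) (sum-remove (removeAt f i)) ⟩
  f i + (f (punchIn i o) + sum (removeAt (removeAt f i) o))
    ≡⟨ cong₂ (λ u v → f i + (f u + v)) (FP.punchIn-punchOut i≢i') (sum-zero rest′) ⟩
  f i + (f i' + 0ℤ)                                ≡⟨ cong (f i +_) (ℤP.+-identityʳ (f i')) ⟩
  f i + f i'                                       ∎
  where
  open ≡-Reasoning
  o = punchOut i≢i'
  rest′ : ∀ k → removeAt (removeAt f i) o k ≡ 0ℤ
  rest′ k = rest _ (FP.punchInᵢ≢i i _) λ hit →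
    FP.punchInᵢ≢i o k (FP.punchIn-injective i _ _ (trans hit (sym (FP.punchIn-punchOut i≢i'))))

sumFin-in-entry : ∀ m s d (y x : Fin m → ℤ) →
  s * (sumFin m (λ j → y j * x j) * d) ≡ sumFin m (λ j → (s * (y j * d)) * x j)
sumFin-in-entry m s d y x = begin
  s * (sumFin m (λ j → y j * x j) * d)      ≡⟨ pull s _ d ⟩
  (s * d) * sumFin m (λ j → y j * x j)      ≡⟨ *-distribˡ-sumFin m (s * d) (λ j → y j * x j) ⟩
  sumFin m (λ j → (s * d) * (y j * x j))    ≡⟨ sumFin-cong m (λ j → shuffle s d (y j) (x j)) ⟩
  sumFin m (λ j → (s * (y j * d)) * x j)    ∎
  where
  open ≡-Reasoning
  pull : ∀ s t d → s * (t * d) ≡ (s * d) * t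
  pull = solve-∀
  shuffle : ∀ s d u v → (s * d) * (u * v) ≡ (s * (u * d)) * v
  shuffle = solve-∀

sumFin-in-minor : ∀ m s y (d x : Fin m → ℤ) →
  s * (y * sumFin m (λ j → d j * x j)) ≡ sumFin m (λ j → (s * (y * d j)) * x j)
sumFin-in-minor m s y d x = begin
  s * (y * sumFin m (λ j → d j * x j))      ≡⟨ ℤP.*-assoc s y _ ⟨
  (s * y) * sumFin m (λ j → d j * x j)      ≡⟨ *-distribˡ-sumFin m (s * y) (λ j → d j * x j) ⟩
  sumFin m (λ j → (s * y) * (d j * x j))    ≡⟨ sumFin-cong m (λ j → shuffle s y (d j) (x j)) ⟩
  sumFin m (λ j → (s * (y * d j)) * x j)    ∎
  where
  open ≡-Reasoning
  shuffle : ∀ s y u v → (s * y) * (u * v) ≡ (s * (y * u)) * v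
  shuffle = solve-∀

i≡-i⇒i≡0 : ∀ i → i ≡ - i → i ≡ 0ℤ
i≡-i⇒i≡0 (ℤ.+ zero) _ = refl
i≡-i⇒i≡0 +[1+ _ ]   ()
i≡-i⇒i≡0 -[1+ _ ]   ()

punchIn≢ : ∀ {n} {j b : Fin (suc n)} (j≢b : j ≢ b) {c : Fin n} → c ≢ punchOut j≢b → punchIn j c ≢ b
punchIn≢ {j = j} j≢b {c} c≢ hit = c≢ (FP.punchIn-injective j c _ (trans hit (sym (FP.punchIn-punchOut j≢b))))

transpose-ˡ : ∀ {n} (i j : Fin n) → PC.transpose i j i ≡ j
transpose-ˡ i j rewrite dec-true (i F.≟ i) refl = refl

transpose-ʳ : ∀ {n} (i j : Fin n) → PC.transpose i j j ≡ i
transpose-ʳ i j with j F.≟ i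
... | yes j≡i = j≡i
... | no  _   rewrite dec-true (j F.≟ j) refl = refl

transpose-other : ∀ {n} {i j k : Fin n} → k ≢ i → k ≢ j → PC.transpose i j k ≡ k
transpose-other {i = i} {j} {k} k≢i k≢j rewrite dec-false (k F.≟ i) k≢i | dec-false (k F.≟ j) k≢j = refl

transpose-natural : ∀ {m n} (f : Fin m → Fin n) → Injective _≡_ _≡_ f →
  ∀ i j e → f (PC.transpose i j e) ≡ PC.transpose (f i) (f j) (f e)
transpose-natural f f-inj i j e with e F.≟ i
... | yes refl = sym (transpose-ˡ (f e) (f j))
... | no e≢i with e F.≟ j
...   | yes refl = sym (transpose-ʳ (f i) (f e))
...   | no e≢j   = sym (transpose-other (e≢i ∘ f-inj) (e≢j ∘ f-inj))

punchIn-transpose : ∀ {n} {c p p' : Fin (suc n)} (c≢p : c ≢ p) (c≢p' : c ≢ p') (e : Fin n) →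
  punchIn c (PC.transpose (punchOut c≢p) (punchOut c≢p') e) ≡ PC.transpose p p' (punchIn c e)
punchIn-transpose {c = c} c≢p c≢p' e =
  trans (transpose-natural (punchIn c) (FP.punchIn-injective c _ _) _ _ e)
        (cong₂ (λ q q' → PC.transpose q q' (punchIn c e)) (FP.punchIn-punchOut c≢p) (FP.punchIn-punchOut c≢p'))

Adjacent : ∀ {n} → Fin n → Fin n → Set
Adjacent p p' = toℕ p' ≡ suc (toℕ p)

punchOut-adjacent : ∀ {n} {c p p' : Fin (suc n)} (c≢p : c ≢ p) (c≢p' : c ≢ p') →
  Adjacent p p' → Adjacent (punchOut c≢p) (punchOut c≢p')
punchOut-adjacent {c = zero} {zero} c≢p _ _ = ⊥-elim (c≢p refl)
punchOut-adjacent {c = zero} {suc p} {zero} _ _ ()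
punchOut-adjacent {c = zero} {suc p} {suc p'} _ _ adj = ℕP.suc-injective adj
punchOut-adjacent {suc n} {suc zero} {zero} {suc zero} _ c≢p' _ = ⊥-elim (c≢p' refl)
punchOut-adjacent {suc (suc n)} {suc (suc c)} {zero} {suc zero} _ _ _ = refl
punchOut-adjacent {suc n} {suc c} {zero} {suc (suc p')} _ _ ()
punchOut-adjacent {suc n} {suc c} {suc p} {zero} _ _ ()
punchOut-adjacent {suc n} {suc c} {suc p} {suc p'} c≢p c≢p' adj =
  cong suc (punchOut-adjacent (c≢p ∘ cong suc) (c≢p' ∘ cong suc) (ℕP.suc-injective adj))

punchIn-adjacent : ∀ {n} {p p' : Fin (suc n)} → Adjacent p p' → ∀ e →
  punchIn p e ≡ punchIn p' e ⊎ (punchIn p e ≡ p' × punchIn p' e ≡ p)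
punchIn-adjacent {p = zero} {suc zero}     _ zero    = inj₂ (refl , refl)
punchIn-adjacent {p = zero} {suc zero}     _ (suc e) = inj₁ refl
punchIn-adjacent {p = zero} {suc (suc p')} ()
punchIn-adjacent {p = zero} {zero}         ()
punchIn-adjacent {p = suc p} {zero}        ()
punchIn-adjacent {suc n} {suc p} {suc p'} _ zero = inj₁ refl
punchIn-adjacent {suc n} {suc p} {suc p'} adj (suc e) with punchIn-adjacent (ℕP.suc-injective adj) e
... | inj₁ same         = inj₁ (cong suc same)
... | inj₂ (hit , hit') = inj₂ (cong suc hit , cong suc hit')

transpose-punchIn-adjacent : ∀ {n} {p p' : Fin (suc n)} → Adjacent p p' → ∀ e →
  PC.transpose p p' (punchIn p e) ≡ punchIn p' e × PC.transpose p p' (punchIn p' e) ≡ punchIn p e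
transpose-punchIn-adjacent {p = p} {p'} adj e with punchIn-adjacent adj e
... | inj₁ same = fixed , trans (cong (PC.transpose p p') (sym same)) (trans fixed (sym same))
  where
  fixed : PC.transpose p p' (punchIn p e) ≡ punchIn p' e
  fixed = trans (transpose-other (FP.punchInᵢ≢i p e) (λ hit → FP.punchInᵢ≢i p' e (trans (sym same) hit))) same
... | inj₂ (hit , hit') =
  trans (cong (PC.transpose p p') hit) (trans (transpose-ʳ p p') (sym hit')) ,
  trans (cong (PC.transpose p p') hit') (trans (transpose-ˡ p p') (sym hit))

sgn-toℕ : ∀ {n n'} (i : Fin n) (i' : Fin n') → toℕ i ≡ toℕ i' → sgn i ≡ sgn i'
sgn-toℕ zero    zero     _ = refl
sgn-toℕ (suc i) (suc i') e = cong -_ (sgn-toℕ i i' (ℕP.suc-injective e))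

sgn-adjacent : ∀ {n} {p p' : Fin n} → Adjacent p p' → sgn p' ≡ - sgn p
sgn-adjacent {p = p} {suc p'} adj = cong -_ (sgn-toℕ p' p (ℕP.suc-injective adj))

-- Laplace expansion: multilinearity and alternation in the columns

minor : ∀ {n} → Matrix (suc n) (suc n) → Fin (suc n) → Matrix n n
minor M j a c = M (suc a) (punchIn j c)

laplaceTerm : ∀ {n} → Matrix (suc n) (suc n) → Fin (suc n) → ℤ
laplaceTerm {n} M j = sgn j * (M zero j * det n (minor M j))

det-cong : ∀ n {M N : Matrix n n} → (∀ a c → M a c ≡ N a c) → det n M ≡ det n N
det-cong zero    M≗N = refl
det-cong (suc n) M≗N = sumFin-cong (suc n) λ j →
  cong₂ (λ u v → sgn j * (u * v)) (M≗N zero j) (det-cong n (λ a c → M≗N (suc a) (punchIn j c)))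

det-linear-column : ∀ n {m} (M : Matrix n n) (Ms : Fin m → Matrix n n) (x : Fin m → ℤ) (b : Fin n) →
  (∀ j a c → c ≢ b → Ms j a c ≡ M a c) →
  (∀ a → M a b ≡ sumFin m (λ j → Ms j a b * x j)) →
  det n M ≡ sumFin m (λ j → det n (Ms j) * x j)
det-linear-column (suc n) {m} M Ms x b off at = begin
  det (suc n) M                                                      ≡⟨ sumFin-cong (suc n) term ⟩
  sumFin (suc n) (λ c → sumFin m (λ j → laplaceTerm (Ms j) c * x j))
    ≡⟨ sumFin-comm (suc n) m (λ c j → laplaceTerm (Ms j) c * x j) ⟩
  sumFin m (λ j → sumFin (suc n) (λ c → laplaceTerm (Ms j) c * x j))
    ≡⟨ sumFin-cong m (λ j → *-distribʳ-sumFin (suc n) (x j) (laplaceTerm (Ms j))) ⟨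
  sumFin m (λ j → det (suc n) (Ms j) * x j)                           ∎
  where
  open ≡-Reasoning
  term : ∀ c → laplaceTerm M c ≡ sumFin m (λ j → laplaceTerm (Ms j) c * x j)
  term c with toSum (c F.≟ b)
  ... | inj₁ refl = begin
    sgn c * (M zero c * det n (minor M c))                ≡⟨ cong (λ v → sgn c * (v * _)) (at zero) ⟩
    sgn c * (sumFin m (λ j → Ms j zero c * x j) * det n (minor M c))
      ≡⟨ sumFin-in-entry m (sgn c) _ (λ j → Ms j zero c) x ⟩
    sumFin m (λ j → (sgn c * (Ms j zero c * det n (minor M c))) * x j)
      ≡⟨ sumFin-cong m (λ j → cong (λ v → (sgn c * (Ms j zero c * v)) * x j) (same-minor j)) ⟩
    sumFin m (λ j → laplaceTerm (Ms j) c * x j)            ∎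
    where
    same-minor : ∀ j → det n (minor M c) ≡ det n (minor (Ms j) c)
    same-minor j = det-cong n (λ a e → sym (off j (suc a) (punchIn c e) (FP.punchInᵢ≢i c e)))
  ... | inj₂ c≢b = begin
    sgn c * (M zero c * det n (minor M c))                ≡⟨ cong (λ v → sgn c * (M zero c * v)) minor-linear ⟩
    sgn c * (M zero c * sumFin m (λ j → D j * x j))        ≡⟨ sumFin-in-minor m (sgn c) (M zero c) D x ⟩
    sumFin m (λ j → (sgn c * (M zero c * D j)) * x j)
      ≡⟨ sumFin-cong m (λ j → cong (λ v → (sgn c * (v * D j)) * x j) (sym (off j zero c c≢b))) ⟩
    sumFin m (λ j → laplaceTerm (Ms j) c * x j)            ∎
    where
    D : Fin m → ℤ
    D j = det n (minor (Ms j) c)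
    minor-linear : det n (minor M c) ≡ sumFin m (λ j → D j * x j)
    minor-linear = det-linear-column n (minor M c) (λ j → minor (Ms j) c) x (punchOut c≢b)
      (λ j a e e≢ → off j (suc a) (punchIn c e) (punchIn≢ c≢b e≢))
      (λ a → subst (λ v → M (suc a) v ≡ sumFin m (λ j → Ms j (suc a) v * x j))
                   (sym (FP.punchIn-punchOut c≢b)) (at (suc a)))

det-zero-column : ∀ n (M : Matrix n n) (b : Fin n) → (∀ a → M a b ≡ 0ℤ) → det n M ≡ 0ℤ
det-zero-column n M b zero-at-b = det-linear-column n {0} M (λ ()) (λ ()) b (λ ()) zero-at-b

laplaceTerm-reindex : ∀ {n} (M : Matrix (suc n) (suc n)) (σ : Fin (suc n) → Fin (suc n)) {u v} →
  sgn u ≡ - sgn v → σ u ≡ v → (∀ e → σ (punchIn u e) ≡ punchIn v e) →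
  laplaceTerm (λ a c → M a (σ c)) u ≡ - laplaceTerm M v
laplaceTerm-reindex {n} M σ {u} {v} sgn-u σu≡v σ-minor = begin
  sgn u * (M zero (σ u) * det n (λ a e → M (suc a) (σ (punchIn u e))))
    ≡⟨ cong₂ (λ s w → s * (M zero w * _)) sgn-u σu≡v ⟩
  (- sgn v) * (M zero v * det n (λ a e → M (suc a) (σ (punchIn u e))))
    ≡⟨ cong (λ d → (- sgn v) * (M zero v * d)) (det-cong n (λ a e → cong (M (suc a)) (σ-minor e))) ⟩
  (- sgn v) * (M zero v * det n (minor M v))     ≡⟨ ℤP.neg-distribˡ-* (sgn v) _ ⟨
  - laplaceTerm M v                              ∎
  where open ≡-Reasoning

det-transpose-adjacent : ∀ n (M : Matrix n n) {p p' : Fin n} → Adjacent p p' →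
  det n (λ a c → M a (PC.transpose p p' c)) ≡ - det n M
det-transpose-adjacent (suc n) M {p} {p'} adj = begin
  det (suc n) Mτ                                  ≡⟨ sumFin-cong (suc n) term ⟩
  sumFin (suc n) ((λ c → - laplaceTerm M c) ∘ τ)  ≡⟨ sumFin-transpose (suc n) (λ c → - laplaceTerm M c) p p' ⟩
  sumFin (suc n) (λ c → - laplaceTerm M c)        ≡⟨ neg-distrib-sumFin (suc n) (laplaceTerm M) ⟨
  - det (suc n) M                                 ∎
  where
  open ≡-Reasoning
  τ = PC.transpose p p'
  Mτ : Matrix (suc n) (suc n)
  Mτ a c = M a (τ c)
  sgn-p : sgn p ≡ - sgn p'
  sgn-p = trans (sym (ℤP.neg-involutive (sgn p))) (cong -_ (sym (sgn-adjacent adj)))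
  term : ∀ c → laplaceTerm Mτ c ≡ - laplaceTerm M (τ c)
  term c with toSum (c F.≟ p) | toSum (c F.≟ p')
  ... | inj₁ refl | _ =
    trans (laplaceTerm-reindex M τ {c} sgn-p (transpose-ˡ p p')
                               (proj₁ ∘ transpose-punchIn-adjacent adj))
          (cong (-_ ∘ laplaceTerm M) (sym (transpose-ˡ p p')))
  ... | inj₂ _ | inj₁ refl =
    trans (laplaceTerm-reindex M τ {c} (sgn-adjacent adj) (transpose-ʳ p p')
                               (proj₂ ∘ transpose-punchIn-adjacent adj))
          (cong (-_ ∘ laplaceTerm M) (sym (transpose-ʳ p p')))
  ... | inj₂ c≢p | inj₂ c≢p' = begin
    sgn c * (M zero (τ c) * det n (minor Mτ c))  ≡⟨ cong (λ u → sgn c * (M zero u * det n (minor Mτ c))) τc≡c ⟩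
    sgn c * (M zero c * det n (minor Mτ c))      ≡⟨ cong (λ v → sgn c * (M zero c * v)) minor-transposed ⟩
    sgn c * (M zero c * - det n (minor M c))     ≡⟨ neg-inside (sgn c) (M zero c) _ ⟩
    - laplaceTerm M c                            ≡⟨ cong (-_ ∘ laplaceTerm M) τc≡c ⟨
    - laplaceTerm M (τ c)                        ∎
    where
    τc≡c : τ c ≡ c
    τc≡c = transpose-other c≢p c≢p'
    neg-inside : ∀ s y d → s * (y * - d) ≡ - (s * (y * d))
    neg-inside = solve-∀
    minor-transposed : det n (minor Mτ c) ≡ - det n (minor M c)
    minor-transposed = trans
      (det-cong n (λ a e → cong (M (suc a)) (sym (punchIn-transpose c≢p c≢p' e))))
      (det-transpose-adjacent n (minor M c) (punchOut-adjacent c≢p c≢p' adj))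
transpose-equal-columns : ∀ {r n} (M : Matrix r n) {c c' : Fin n} → (∀ a → M a c ≡ M a c') →
  ∀ a e → M a (PC.transpose c c' e) ≡ M a e
transpose-equal-columns M {c} {c'} same a e with toSum (e F.≟ c) | toSum (e F.≟ c')
... | inj₁ refl | _         = trans (cong (M a) (transpose-ˡ c c')) (sym (same a))
... | inj₂ _    | inj₁ refl = trans (cong (M a) (transpose-ʳ c c')) (same a)
... | inj₂ e≢c  | inj₂ e≢c' = cong (M a) (transpose-other e≢c e≢c')

det-equal-columns-at-distance : ∀ d n (M : Matrix n n) {c c' : Fin n} → d ℕ.+ suc (toℕ c) ≡ toℕ c' →
  (∀ a → M a c ≡ M a c') → det n M ≡ 0ℤ
-- Swapping two equal adjacent columns leaves M unchanged but negates its determinant.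
det-equal-columns-at-distance zero n M {c} {c'} adj same = i≡-i⇒i≡0 (det n M) (begin
  det n M                                     ≡⟨ det-cong n (transpose-equal-columns M same) ⟨
  det n (λ a e → M a (PC.transpose c c' e))   ≡⟨ det-transpose-adjacent n M (sym adj) ⟩
  - det n M                                   ∎)
  where open ≡-Reasoning
det-equal-columns-at-distance (suc d) n M {c' = zero} ()
det-equal-columns-at-distance (suc d) (suc n) M {c} {suc c₀} dist same = ℤP.neg-injective (begin
  - det (suc n) M   ≡⟨ det-transpose-adjacent (suc n) M adj ⟨
  det (suc n) N     ≡⟨ det-equal-columns-at-distance d (suc n) N dist′ same′ ⟩
  0ℤ                ∎)
  where
  open ≡-Reasoning
  p p' : Fin (suc n)
  p  = inject₁ c₀
  p' = suc c₀
  N : Matrix (suc n) (suc n)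
  N a e = M a (PC.transpose p p' e)
  adj : Adjacent p p'
  adj = cong suc (sym (FP.toℕ-inject₁ c₀))
  dist′ : d ℕ.+ suc (toℕ c) ≡ toℕ p
  dist′ = trans (ℕP.suc-injective dist) (sym (FP.toℕ-inject₁ c₀))
  c≢p : c ≢ p
  c≢p c≡p = ℕP.<⇒≢ (ℕP.m≤n+m (suc (toℕ c)) d) (trans (cong toℕ c≡p) (sym dist′))
  c≢p' : c ≢ p'
  c≢p' c≡p' = ℕP.<⇒≢ (ℕP.m≤n+m (suc (toℕ c)) (suc d)) (trans (cong toℕ c≡p') (sym dist))
  same′ : ∀ a → N a c ≡ N a p
  same′ a = trans (cong (M a) (transpose-other c≢p c≢p')) (trans (same a) (cong (M a) (sym (transpose-ˡ p p'))))

det-equal-columns : ∀ n (M : Matrix n n) {c c' : Fin n} → c ≢ c' → (∀ a → M a c ≡ M a c') → det n M ≡ 0ℤ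
det-equal-columns n M {c} {c'} c≢c' same with FP.<-cmp c c'
... | tri< c<c' _ _ = det-equal-columns-at-distance _ n M (ℕP.m∸n+n≡m c<c') same
... | tri≈ _ c≡c' _ = ⊥-elim (c≢c' c≡c')
... | tri> _ _ c'<c = det-equal-columns-at-distance _ n M (ℕP.m∸n+n≡m c'<c) (sym ∘ same)

-- The Cramer identity and exchanging columns of a nonsingular minor

submatrix : ∀ {r m k} → Matrix r m → (Fin k → Fin r) → (Fin k → Fin m) → Matrix k k
submatrix A ρ κ a b = A (ρ a) (κ b)

_[_]≔_ : ∀ {k m} → (Fin k → Fin m) → Fin k → Fin m → Fin k → Fin m
κ [ b ]≔ j = updateAt κ b (const j)

[]≔-at : ∀ {k m} (κ : Fin k → Fin m) b {j} → (κ [ b ]≔ j) b ≡ j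
[]≔-at κ b = updateAt-updates b κ

[]≔-off : ∀ {k m} (κ : Fin k → Fin m) {b c j} → c ≢ b → (κ [ b ]≔ j) c ≡ κ c
[]≔-off κ c≢b = updateAt-minimal _ _ κ c≢b

Avoids : ∀ {k m} → (Fin k → Fin m) → Fin m → Set
Avoids κ j = ∀ b → κ b ≢ j

[]≔-injective : ∀ {k m} {κ : Fin k → Fin m} → Injective _≡_ _≡_ κ → ∀ b {j} → Avoids κ j →
  Injective _≡_ _≡_ (κ [ b ]≔ j)
[]≔-injective {κ = κ} κ-inj b avoids {c} {c'} eq with toSum (c F.≟ b) | toSum (c' F.≟ b)
... | inj₁ c≡b | inj₁ c'≡b = trans c≡b (sym c'≡b)
... | inj₁ refl | inj₂ c'≢b = ⊥-elim (avoids c' (sym (trans (sym ([]≔-at κ c)) (trans eq ([]≔-off κ c'≢b)))))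
... | inj₂ c≢b  | inj₁ refl = ⊥-elim (avoids c (trans (sym ([]≔-off κ c≢b)) (trans eq ([]≔-at κ c'))))
... | inj₂ c≢b  | inj₂ c'≢b = κ-inj (trans (sym ([]≔-off κ c≢b)) (trans eq ([]≔-off κ c'≢b)))

[]≔-avoids : ∀ {k m} {κ : Fin k → Fin m} {b j j''} → (∀ b' → b' ≢ b → κ b' ≢ j) → j'' ≢ j →
  Avoids (κ [ b ]≔ j'') j
[]≔-avoids {κ = κ} {b} avoids-off-b j''≢j b' with toSum (b' F.≟ b)
... | inj₁ refl = λ hit → j''≢j (trans (sym ([]≔-at κ b')) hit)
... | inj₂ b'≢b = λ hit → avoids-off-b b' b'≢b (trans (sym ([]≔-off κ b'≢b)) hit)

cramer : ∀ {r m k} (A : Matrix r m) {x : Fin m → ℤ} → IsSolution A x →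
  (ρ : Fin k → Fin r) (κ : Fin k → Fin m) (b : Fin k) →
  sumFin m (λ j → det k (submatrix A ρ (κ [ b ]≔ j)) * x j) ≡ 0ℤ
cramer {m = m} {k} A {x} sol ρ κ b =
  trans (sym (det-linear-column k M Ms x b off at)) (det-zero-column k M b zero-at-b)
  where
  -- M is A[ρ, κ] with column b replaced by Σⱼ xⱼ A[ρ, j], which is zero as x is a solution.
  M : Matrix k k
  M a = updateAt (submatrix A ρ κ a) b (const 0ℤ)
  Ms : Fin m → Matrix k k
  Ms j = submatrix A ρ (κ [ b ]≔ j)
  off : ∀ j a c → c ≢ b → Ms j a c ≡ M a c
  off j a c c≢b = trans (cong (A (ρ a)) ([]≔-off κ c≢b)) (sym (updateAt-minimal c b _ c≢b))
  zero-at-b : ∀ a → M a b ≡ 0ℤ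
  zero-at-b a = updateAt-updates b (submatrix A ρ κ a)
  at : ∀ a → M a b ≡ sumFin m (λ j → Ms j a b * x j)
  at a = trans (zero-at-b a) (trans (sym (sol (ρ a)))
    (sumFin-cong m (λ j → cong (λ c → A (ρ a) c * x j) (sym ([]≔-at κ b)))))

cramer-two-terms : ∀ {r m k} (A : Matrix r m) {x : Fin m → ℤ} → IsSolution A x →
  (ρ : Fin k → Fin r) (κ : Fin k → Fin m) (b : Fin k) {j' : Fin m} → j' ≢ κ b →
  (∀ j → j ≢ κ b → j ≢ j' → Avoids κ j → det k (submatrix A ρ (κ [ b ]≔ j)) ≡ 0ℤ) →
  det k (submatrix A ρ κ) * x (κ b) + det k (submatrix A ρ (κ [ b ]≔ j')) * x j' ≡ 0ℤ
cramer-two-terms {m = m} {k} A {x} sol ρ κ b {j'} j'≢κb vanish = begin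
  det k (submatrix A ρ κ) * x (κ b) + f j'  ≡⟨ cong (λ d → d * x (κ b) + f j') (det-cong k unchanged) ⟩
  f (κ b) + f j'                            ≡⟨ sumFin-pair m f (j'≢κb ∘ sym) others ⟨
  sumFin m f                                ≡⟨ cramer A sol ρ κ b ⟩
  0ℤ                                        ∎
  where
  open ≡-Reasoning
  f : Fin m → ℤ
  f j = det k (submatrix A ρ (κ [ b ]≔ j)) * x j
  unchanged : ∀ a c → submatrix A ρ κ a c ≡ submatrix A ρ (κ [ b ]≔ κ b) a c
  unchanged a c = cong (A (ρ a)) (sym (updateAt-id-local b κ refl c))
  others : ∀ j → j ≢ κ b → j ≢ j' → f j ≡ 0ℤ
  others j j≢κb j≢j' with FP.any? (λ b' → κ b' F.≟ j)
  ... | no miss = cong (_* x j) (vanish j j≢κb j≢j' (λ b' κb'≡j → miss (b' , κb'≡j)))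
  ... | yes (b' , κb'≡j) = cong (_* x j) (det-equal-columns k _ b≢b' same)
    where
    b≢b' : b ≢ b'
    b≢b' b≡b' = j≢κb (trans (sym κb'≡j) (cong κ (sym b≡b')))
    same : ∀ a → A (ρ a) ((κ [ b ]≔ j) b) ≡ A (ρ a) ((κ [ b ]≔ j) b')
    same a = cong (A (ρ a)) (trans ([]≔-at κ b) (sym (trans ([]≔-off κ (b≢b' ∘ sym)) κb'≡j)))

LinearRelation : ∀ {r m} → Matrix r m → Fin m → Fin m → ℤ → ℤ → Set
LinearRelation A i j α β = ∀ x → IsSolution A x → α * x i + β * x j ≡ 0ℤ

NoTwoColumnRelation : ∀ {r m} → Matrix r m → Set
NoTwoColumnRelation {m = m} A = ∀ {i j : Fin m} → i ≢ j → ∀ α β → α ≢ 0ℤ → ¬ LinearRelation A i j α β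

Nonsingular : ∀ {r m k} → Matrix r m → (Fin k → Fin r) → (Fin k → Fin m) → Set
Nonsingular {k = k} A ρ κ = Injective _≡_ _≡_ κ × det k (submatrix A ρ κ) ≢ 0ℤ

avoids? : ∀ {k m} (κ : Fin k → Fin m) j → Dec (Avoids κ j)
avoids? κ j = FP.all? (λ b → ¬? (κ b F.≟ j))

exchange : ∀ {r m k} (A : Matrix r m) → NoTwoColumnRelation A →
  (ρ : Fin k → Fin r) (κ : Fin k → Fin m) → det k (submatrix A ρ κ) ≢ 0ℤ →
  ∀ b {j'} → j' ≢ κ b →
  ∃ λ j → Avoids κ j × j ≢ j' × det k (submatrix A ρ (κ [ b ]≔ j)) ≢ 0ℤ
exchange {k = k} A noRelation ρ κ det≢0 b {j'} j'≢κb
  with FP.any? (λ j → avoids? κ j ×-dec ¬? (j F.≟ j') ×-dec ¬? (det k (submatrix A ρ (κ [ b ]≔ j)) ℤ.≟ 0ℤ))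
... | yes found = found
... | no none   = ⊥-elim (noRelation (j'≢κb ∘ sym) _ (det k (submatrix A ρ (κ [ b ]≔ j'))) det≢0 relation)
  where
  vanish : ∀ j → j ≢ κ b → j ≢ j' → Avoids κ j → det k (submatrix A ρ (κ [ b ]≔ j)) ≡ 0ℤ
  vanish j _ j≢j' avoids with det k (submatrix A ρ (κ [ b ]≔ j)) ℤ.≟ 0ℤ
  ... | yes d≡0 = d≡0
  ... | no  d≢0 = ⊥-elim (none (j , avoids , j≢j' , d≢0))
  relation : LinearRelation A (κ b) j' (det k (submatrix A ρ κ)) (det k (submatrix A ρ (κ [ b ]≔ j')))
  relation x sol = cramer-two-terms A sol ρ κ b j'≢κb vanish

avoid-column : ∀ {r m k} (A : Matrix r m) → NoTwoColumnRelation A →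
  {ρ : Fin k → Fin r} {κ : Fin k → Fin m} → Nonsingular A ρ κ → ∀ {j j'} → j ≢ j' →
  ∃ λ κ' → Nonsingular A ρ κ' × Avoids κ' j × (Avoids κ j' → Avoids κ' j')
avoid-column A noRelation {ρ} {κ} (κ-inj , det≢0) {j} {j'} j≢j' with FP.any? (λ b → κ b F.≟ j)
... | no miss = κ , (κ-inj , det≢0) , (λ b hit → miss (b , hit)) , λ avoids → avoids
... | yes (b , κb≡j) =
  let (j'' , avoids-j'' , j''≢j' , det''≢0) =
        exchange A noRelation ρ κ det≢0 b (λ j'≡κb → j≢j' (sym (trans j'≡κb κb≡j)))
  in  κ [ b ]≔ j'' , ([]≔-injective κ-inj b avoids-j'' , det''≢0)
    , []≔-avoids (λ b' b'≢b hit → b'≢b (κ-inj (trans hit (sym κb≡j))))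
                 (λ j''≡j → avoids-j'' b (trans κb≡j (sym j''≡j)))
    , λ avoids-j' → []≔-avoids (λ b' _ → avoids-j' b') j''≢j'

avoid-two-columns : ∀ {r m k} (A : Matrix r m) → NoTwoColumnRelation A →
  {ρ : Fin k → Fin r} {κ : Fin k → Fin m} → Nonsingular A ρ κ → ∀ {j₁ j₂} → j₁ ≢ j₂ →
  ∃ λ κ' → Nonsingular A ρ κ' × Avoids κ' j₁ × Avoids κ' j₂
avoid-two-columns A noRelation nonsingular j₁≢j₂ =
  let (κ₁ , nonsingular₁ , avoids₁ , _)    = avoid-column A noRelation nonsingular j₁≢j₂
      (κ₂ , nonsingular₂ , avoids₂ , keep) = avoid-column A noRelation nonsingular₁ (j₁≢j₂ ∘ sym)
  in  κ₂ , nonsingular₂ , keep avoids₁ , avoids₂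

deleteTwo-minor⇒minor : ∀ {r m k} (A : Matrix r (suc (suc m))) {j₁ j₂} (j₁≢j₂ : j₁ ≢ j₂) →
  HasNonzeroMinor (deleteTwo A j₁ j₂ j₁≢j₂) k → HasNonzeroMinor A k
deleteTwo-minor⇒minor A {j₁} j₁≢j₂ (ρ , κ , ρ-inj , κ-inj , det≢0) =
  ρ , punchIn j₁ ∘ punchIn (punchOut j₁≢j₂) ∘ κ , ρ-inj ,
  κ-inj ∘ FP.punchIn-injective _ _ _ ∘ FP.punchIn-injective _ _ _ , det≢0

punchIn-punchIn-onto : ∀ {m} {j₁ j₂ : Fin (suc (suc m))} (j₁≢j₂ : j₁ ≢ j₂) {j} → j₁ ≢ j → j₂ ≢ j →
  ∃ λ j₀ → punchIn j₁ (punchIn (punchOut j₁≢j₂) j₀) ≡ j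
punchIn-punchIn-onto {j₁ = j₁} j₁≢j₂ j₁≢j j₂≢j =
  punchOut (j₂≢j ∘ FP.punchOut-injective j₁≢j₂ j₁≢j) ,
  trans (cong (punchIn j₁) (FP.punchIn-punchOut _)) (FP.punchIn-punchOut j₁≢j)

minor⇒deleteTwo-minor : ∀ {r m k} (A : Matrix r (suc (suc m))) → NoTwoColumnRelation A →
  ∀ {j₁ j₂} (j₁≢j₂ : j₁ ≢ j₂) → HasNonzeroMinor A k → HasNonzeroMinor (deleteTwo A j₁ j₂ j₁≢j₂) k
minor⇒deleteTwo-minor {k = k} A noRelation {j₁} {j₂} j₁≢j₂ (ρ , κ , ρ-inj , κ-inj , det≢0) =
  let (κ' , (κ'-inj , det'≢0) , avoids₁ , avoids₂) = avoid-two-columns A noRelation (κ-inj , det≢0) j₁≢j₂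
      reinsert : ∀ b → ∃ λ j₀ → punchIn j₁ (punchIn (punchOut j₁≢j₂) j₀) ≡ κ' b
      reinsert b = punchIn-punchIn-onto j₁≢j₂ (avoids₁ b ∘ sym) (avoids₂ b ∘ sym)
      κ₀-inj : Injective _≡_ _≡_ (proj₁ ∘ reinsert)
      κ₀-inj {b} {b'} eq = κ'-inj (trans (sym (proj₂ (reinsert b)))
                                         (trans (cong (punchIn j₁ ∘ punchIn _) eq) (proj₂ (reinsert b'))))
  in  ρ , proj₁ ∘ reinsert , ρ-inj , κ₀-inj ,
      det'≢0 ∘ trans (sym (det-cong k (λ a b → cong (A (ρ a)) (proj₂ (reinsert b)))))

noTwoColumnRelation⇒abundant : ∀ {r m} (A : Matrix r m) → NoTwoColumnRelation A → Abundant A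
noTwoColumnRelation⇒abundant {m = zero}        A _ = tt
noTwoColumnRelation⇒abundant {m = suc zero}    A _ = tt
noTwoColumnRelation⇒abundant {m = suc (suc m)} A noRelation j₁ j₂ j₁≢j₂ k (minor , maximal) =
  minor⇒deleteTwo-minor A noRelation j₁≢j₂ minor ,
  λ k' minor' → maximal k' (deleteTwo-minor⇒minor A j₁≢j₂ minor')

-- Regular matrices admit no relation between two columns

Regular : ∀ {r m} → Matrix r m → Set
Regular A = PartitionRegular A ⊎ DensityRegular A

regular⇒positive-solution : ∀ {r m} (A : Matrix r m) → Regular A →
  ∃ λ n → ∃ λ (y : Fin m → Fin n) → InS₀ A (elt ∘ y)
regular⇒positive-solution A (inj₁ (_ , monochromatic)) =
  let (n₀ , large)      = monochromatic 1
      (_ , y , _ , sol) = large n₀ ℕP.≤-refl (λ _ → zero)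
  in  n₀ , y , sol
regular⇒positive-solution A (inj₂ (_ , dense)) =
  let (n₀ , large)  = dense 1 1 ℕP.≤-refl ℕP.≤-refl
      (y , _ , sol) = large n₀ ℕP.≤-refl ⊤ (ℕP.≤-reflexive (cong (1 ℕ.*_) (sym (SubsetP.∣⊤∣≡n n₀))))
  in  n₀ , y , sol

ForcesRatio : ∀ {r m} → Matrix r m → Fin m → Fin m → ℕ → ℕ → Set
ForcesRatio {m = m} A i j a g =
  ∀ {n} (y : Fin m → Fin n) → InS₀ A (elt ∘ y) → a ℕ.* suc (toℕ (y i)) ≡ g ℕ.* suc (toℕ (y j))

module RatioColouring {a g : ℕ} (g<a : g ℕ.< a) where

  -- chain f w is the parity of the length of w, g w / a, g² w / a², … (continued while a
  -- divides), provided the fuel f exceeds w.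
  chain : ℕ → ℕ → Bool
  chain zero    _         = false
  chain (suc f) zero      = false
  chain (suc f) w@(suc _) with a ∣? g ℕ.* w
  ... | yes (divides q _) = not (chain f q)
  ... | no  _             = false

  quotient< : ∀ {q w} → g ℕ.* suc w ≡ q ℕ.* a → q ℕ.< suc w
  quotient< {q} {w} eq = ℕP.*-cancelʳ-< a q (suc w) (begin-strict
    q ℕ.* a       ≡⟨ eq ⟨
    g ℕ.* suc w   <⟨ ℕP.*-monoˡ-< (suc w) g<a ⟩
    a ℕ.* suc w   ≡⟨ ℕP.*-comm a (suc w) ⟩
    suc w ℕ.* a   ∎)
    where open ℕP.≤-Reasoning

  chain-fuel : ∀ f f' w → w ℕ.< f → w ℕ.< f' → chain f w ≡ chain f' w
  chain-fuel (suc f) (suc f') zero      _ _ = refl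
  chain-fuel (suc f) (suc f') (suc w) w<f w<f' with a ∣? g ℕ.* suc w
  ... | yes (divides q eq) = cong not (chain-fuel f f' q (ℕP.<-≤-trans (quotient< eq) (ℕP.≤-pred w<f))
                                                       (ℕP.<-≤-trans (quotient< eq) (ℕP.≤-pred w<f')))
  ... | no  _              = refl

  colour : ℕ → Bool
  colour w = chain (suc w) w

  colour-flips : ∀ u w → a ℕ.* suc u ≡ g ℕ.* suc w → colour (suc w) ≡ not (colour (suc u))
  colour-flips u w ratio with a ∣? g ℕ.* suc w
  ... | no  a∤gw = ⊥-elim (a∤gw (divides (suc u) (trans (sym ratio) (ℕP.*-comm a (suc u)))))
  ... | yes (divides q eq) = cong not (begin
    chain (suc w) q               ≡⟨ cong (chain (suc w)) q≡u ⟩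
    chain (suc w) (suc u)
      ≡⟨ chain-fuel (suc w) (suc (suc u)) (suc u) (subst (ℕ._< suc w) q≡u (quotient< eq)) ℕP.≤-refl ⟩
    chain (suc (suc u)) (suc u)   ∎)
    where
    open ≡-Reasoning
    instance
      a-nonZero : ℕ.NonZero a
      a-nonZero = ℕ.>-nonZero (ℕP.m<n⇒0<n g<a)
    q≡u : q ≡ suc u
    q≡u = ℕP.*-cancelʳ-≡ q (suc u) a (trans (sym eq) (trans (sym ratio) (ℕP.*-comm a (suc u))))

partitionRegular⇒¬ForcesRatio : ∀ {r m} (A : Matrix r m) → PartitionRegular A →
  ∀ {i j a g} → g ℕ.< a → ¬ ForcesRatio A i j a g
partitionRegular⇒¬ForcesRatio A (_ , monochromatic) {i} {j} g<a forces =
  let (n₀ , large)              = monochromatic 2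
      (_ , y , same-class , sol) = large n₀ ℕP.≤-refl (class ∘ suc ∘ toℕ)
      same-colour : colour (suc (toℕ (y j))) ≡ colour (suc (toℕ (y i)))
      same-colour = class-injective (trans (same-class j) (sym (same-class i)))
  in  not-¬ same-colour (colour-flips _ _ (forces y sol))
  where
  open RatioColouring g<a
  class : ℕ → Fin 2
  class = Inverse.from 2↔Bool ∘ colour
  class-injective : ∀ {u w} → class u ≡ class w → colour u ≡ colour w
  class-injective {u} {w} eq = trans (sym (Inverse.strictlyInverseˡ 2↔Bool (colour u)))
    (trans (cong (Inverse.to 2↔Bool) eq) (Inverse.strictlyInverseˡ 2↔Bool (colour w)))

atLeast : ∀ {n} → ℕ → Subset n
atLeast zero                = ⊤
atLeast {zero}  (suc t)     = []
atLeast {suc n} (suc t)     = outside ∷ atLeast t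

∣atLeast∣ : ∀ n t → ∣ atLeast {n} t ∣ ≡ n ℕ.∸ t
∣atLeast∣ n       zero    = SubsetP.∣⊤∣≡n n
∣atLeast∣ zero    (suc t) = refl
∣atLeast∣ (suc n) (suc t) = ∣atLeast∣ n t

∈atLeast⇒≤ : ∀ {n t} {k : Fin n} → k ∈ atLeast t → t ℕ.≤ toℕ k
∈atLeast⇒≤ {t = zero}              _           = ℕ.z≤n
∈atLeast⇒≤ {suc n} {suc t} {suc k} (there k∈) = ℕ.s≤s (∈atLeast⇒≤ k∈)

densityRegular⇒¬ForcesRatio : ∀ {r m} (A : Matrix r m) → DensityRegular A →
  ∀ {i j a g} → g ℕ.< a → ¬ ForcesRatio A i j a g
densityRegular⇒¬ForcesRatio A (_ , dense) {i} {j} {a} {g} g<a forces =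
  let (n₀ , large)      = dense 1 a ℕP.≤-refl (ℕP.m<n⇒0<n g<a)
      (y , in-top , sol) = large (a ℕ.* n₀) (ℕP.m≤n*m n₀ a) (atLeast (g ℕ.* n₀)) (top-dense n₀)
      top : g ℕ.* n₀ ℕ.< suc (toℕ (y i))
      top = ℕ.s≤s (∈atLeast⇒≤ (in-top i))
      small : suc (toℕ (y j)) ℕ.≤ a ℕ.* n₀
      small = FP.toℕ<n (y j)
  in  ℕP.<-irrefl (sym (forces y sol)) (begin-strict
        g ℕ.* suc (toℕ (y j))   ≤⟨ ℕP.*-monoʳ-≤ g small ⟩
        g ℕ.* (a ℕ.* n₀)        ≡⟨ x∙yz≈y∙xz g a n₀ ⟩
        a ℕ.* (g ℕ.* n₀)        <⟨ ℕP.*-monoʳ-< a top ⟩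
        a ℕ.* suc (toℕ (y i))   ∎)
  where
  open ℕP.≤-Reasoning
  instance
    a-nonZero : ℕ.NonZero a
    a-nonZero = ℕ.>-nonZero (ℕP.m<n⇒0<n g<a)
  a∸g-nonZero : ℕ.NonZero (a ℕ.∸ g)
  a∸g-nonZero = ℕ.>-nonZero (ℕP.m<n⇒0<n∸m g<a)
  top-dense : ∀ n₀ → 1 ℕ.* (a ℕ.* n₀) ℕ.≤ a ℕ.* ∣ atLeast {a ℕ.* n₀} (g ℕ.* n₀) ∣
  top-dense n₀ = begin
    1 ℕ.* (a ℕ.* n₀)                       ≡⟨ ℕP.*-identityˡ _ ⟩
    a ℕ.* n₀                               ≤⟨ ℕP.*-monoʳ-≤ a (ℕP.m≤n*m n₀ (a ℕ.∸ g) {{a∸g-nonZero}}) ⟩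
    a ℕ.* ((a ℕ.∸ g) ℕ.* n₀)               ≡⟨ cong (a ℕ.*_) (ℕP.*-distribʳ-∸ n₀ a g) ⟩
    a ℕ.* (a ℕ.* n₀ ℕ.∸ g ℕ.* n₀)          ≡⟨ cong (a ℕ.*_) (∣atLeast∣ (a ℕ.* n₀) (g ℕ.* n₀)) ⟨
    a ℕ.* ∣ atLeast {a ℕ.* n₀} (g ℕ.* n₀) ∣ ∎

regular⇒¬ForcesRatio< : ∀ {r m} (A : Matrix r m) → Regular A →
  ∀ {i j a g} → g ℕ.< a → ¬ ForcesRatio A i j a g
regular⇒¬ForcesRatio< A (inj₁ partitionRegular) = partitionRegular⇒¬ForcesRatio A partitionRegular
regular⇒¬ForcesRatio< A (inj₂ densityRegular)   = densityRegular⇒¬ForcesRatio A densityRegular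

regular⇒¬ForcesRatio : ∀ {r m} (A : Matrix r m) → Regular A →
  ∀ {i j a g} → i ≢ j → a ≢ 0 → ¬ ForcesRatio A i j a g
regular⇒¬ForcesRatio A regular {i} {j} {a} {g} i≢j a≢0 forces with ℕP.<-cmp g a
... | tri< g<a _ _ = regular⇒¬ForcesRatio< A regular g<a forces
... | tri> _ _ a<g = regular⇒¬ForcesRatio< A regular a<g (λ y sol → sym (forces y sol))
... | tri≈ _ g≡a _ =
  let (_ , y , sol , distinct) = regular⇒positive-solution A regular
  in  distinct i j i≢j (cong ℤ.+_ (ℕP.*-cancelˡ-≡ _ _ a {{ℕ.≢-nonZero a≢0}}
        (trans (forces y (sol , distinct)) (cong (ℕ._* suc (toℕ (y j))) g≡a))))

∣α∣*u≡∣β∣*w : ∀ α β u w → α * ℤ.+ u + β * ℤ.+ w ≡ 0ℤ → ℤ.∣ α ∣ ℕ.* u ≡ ℤ.∣ β ∣ ℕ.* w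
∣α∣*u≡∣β∣*w α β u w sum≡0 = begin
  ℤ.∣ α ∣ ℕ.* u           ≡⟨ ℤP.abs-* α (ℤ.+ u) ⟨
  ℤ.∣ α * ℤ.+ u ∣         ≡⟨ ℤP.∣-i∣≡∣i∣ (α * ℤ.+ u) ⟨
  ℤ.∣ - (α * ℤ.+ u) ∣     ≡⟨ cong ℤ.∣_∣ (inverseʳ-unique (α * ℤ.+ u) (β * ℤ.+ w) sum≡0) ⟨
  ℤ.∣ β * ℤ.+ w ∣         ≡⟨ ℤP.abs-* β (ℤ.+ w) ⟩
  ℤ.∣ β ∣ ℕ.* w           ∎
  where open ≡-Reasoning

linearRelation⇒forcesRatio : ∀ {r m} (A : Matrix r m) {i j} α β →
  LinearRelation A i j α β → ForcesRatio A i j ℤ.∣ α ∣ ℤ.∣ β ∣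
linearRelation⇒forcesRatio A α β relation y (sol , _) = ∣α∣*u≡∣β∣*w α β _ _ (relation (elt ∘ y) sol)

regular⇒noTwoColumnRelation : ∀ {r m} (A : Matrix r m) → Regular A → NoTwoColumnRelation A
regular⇒noTwoColumnRelation A regular i≢j α β α≢0 relation =
  regular⇒¬ForcesRatio A regular {g = ℤ.∣ β ∣} i≢j (α≢0 ∘ ℤP.∣i∣≡0⇒i≡0)
    (linearRelation⇒forcesRatio A α β relation)

lemma2p2 : ∀ {r m : ℕ} (A : Matrix r m) →
    PartitionRegular A ⊎ DensityRegular A → Abundant A
lemma2p2 A regular = noTwoColumnRelation⇒abundant A (regular⇒noTwoColumnRelation A regular)
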